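{- Let $0<q<1$, let $\beta_0,\beta_1,\dots\in\mathbb{R}$ with $\beta_0\ne0$, and let $P_{n,q}(x)$ be defined by $P_{0,q}(x)=1/\beta_0$ and, for $n\ge1$, $P_{n,q}(x)=\frac{(-1)^n}{\beta_0^{n+1}}\det M_n(x)$, where $M_n(x)$ is the $(n+1)\times(n+1)$ matrix with rows and columns indexed by $r,c\in\{0,\dots,n\}$, row $0$ equal to $(1,x,\dots,x^n)$, and entry in row $r\ge1$, column $c$ equal to $\left[\begin{smallmatrix} c\\ r-1\end{smallmatrix}\right]_q\beta_{c-r+1}$ if $c\ge r-1$ and $0$ otherwise. Then for every $n\ge 0$, \[ P_{n,q}(x)=\sum_{j=0}^{n}\left[\begin{smallmatrix} n\\ j\end{smallmatrix}\right]_q P_{n-j,q}(0)\,x^j. \]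
   Context: $[n]_q=\frac{1-q^n}{1-q}$, $[n]_q!=[1]_q\cdots[n]_q$ with $[0]_q!=1$, and $\left[\begin{smallmatrix} n\\ k\end{smallmatrix}\right]_q=\frac{[n]_q!}{[k]_q![n-k]_q!}$. -}

module Defs where

open import Algebra.Bundles using (CommutativeRing)
open import Data.Nat as ℕ using (ℕ; zero; suc; _∸_; _≤?_)
open import Data.Fin using (Fin; zero; suc; toℕ; punchIn)
open import Relation.Nullary using (yes; no)

module QDet {c ℓ} (R : CommutativeRing c ℓ) where
  open CommutativeRing R using (Carrier; _+_; _*_; -_; 0#; 1#)

  pow : Carrier → ℕ → Carrier
  pow a zero    = 1#
  pow a (suc n) = a * pow a n

  sumFin : (n : ℕ) → (Fin n → Carrier) → Carrier
  sumFin zero    f = 0#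
  sumFin (suc n) f = f zero + sumFin n (λ i → f (suc i))

  qbinom : Carrier → ℕ → ℕ → Carrier
  qbinom q n       zero    = 1#
  qbinom q zero    (suc k) = 0#
  qbinom q (suc n) (suc k) = qbinom q n k + pow q (suc k) * qbinom q n (suc k)

  det : (n : ℕ) → (Fin n → Fin n → Carrier) → Carrier
  det zero    M = 1#
  det (suc n) M =
    sumFin (suc n) (λ j → pow (- 1#) (toℕ j) * (M zero j * det n (λ r c → M (suc r) (punchIn j c))))

  -- the (n+1)x(n+1) matrix M_n(x): row 0 is (1, x, ..., x^n);
  -- row r = r'+1 (r' = toℕ of the Fin n index), column c:
  --   [c choose r-1]_q * β_(c-r+1) = [c choose r']_q * β_(c-r')  if c ≥ r-1 = r', else 0
  Mmat : Carrier → (ℕ → Carrier) → (n : ℕ) → Carrier → Fin (suc n) → Fin (suc n) → Carrier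
  Mmat q β n x zero    c = pow x (toℕ c)
  Mmat q β n x (suc r) c with toℕ r ≤? toℕ c
  ... | yes _ = qbinom q (toℕ c) (toℕ r) * β (toℕ c ∸ toℕ r)
  ... | no  _ = 0#

  -- P_{n,q}(x), where b is the inverse 1/β_0 of β_0:
  --   P_0 = 1/β_0,  P_n(x) = (-1)^n / β_0^(n+1) * det M_n(x)  for n ≥ 1
  P : Carrier → (ℕ → Carrier) → Carrier → ℕ → Carrier → Carrier
  P q β b zero    x = b
  P q β b (suc n) x =
    pow (- 1#) (suc n) * (pow b (suc (suc n)) * det (suc (suc n)) (Mmat q β (suc n) x))

{-# OPTIONS --safe #-}
-- Expanding det M_n(x) along its first row gives a sum of (−1)^j x^j D_j, where D_j is the
-- minor without column j. Its rows form a band matrix with entries [c, i]_q β_(c−i) (c ≥ i), so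
-- D_j is block triangular: β_0^j times a Hessenberg determinant H_j(n − j) whose binomial
-- indices are all shifted by j. Expanding H_s(m) along its first row and using
-- [a+b+c, a+b]_q [a+b, a]_q = [a+b+c, a]_q [b+c, b]_q gives H_s(m) = [s+m, s]_q H_0(m) by
-- strong induction on m. As P_m(0) = (−1)^m β_0^(−m−1) H_0(m), collecting signs and powers of
-- β_0 yields the expansion of P_n(x).
module Submission where

open import Defs
open import Algebra.Bundles using (CommutativeRing)
open import Data.Nat using (ℕ; zero; suc; _∸_)
open import Data.Fin using (Fin; toℕ)

open import Data.Nat as ℕ using (_≤_; _<_; s≤s)
import Data.Nat.Properties as ℕₚ
open import Data.Nat.Induction using (<-rec)
open import Data.Fin as Fin using (punchIn; punchOut)
open import Data.Fin.Properties using (toℕ≤pred[n]; punchIn-punchOut)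
open import Function using (_∘_)
open import Relation.Nullary using (yes; no)
open import Relation.Binary.PropositionalEquality as ≡ using (_≡_)

module PowerProperties {c ℓ} (R : CommutativeRing c ℓ) where
  open CommutativeRing R hiding (zero)
  open QDet R using (pow)
  open import Algebra.Properties.Semiring.Exp semiring using (_^_; ^-homo-*)
  open import Algebra.Properties.CommutativeSemigroup *-commutativeSemigroup using (interchange)
  open import Algebra.Properties.Ring ring using (-1*x≈-x; -‿involutive)
  open import Relation.Binary.Reasoning.Setoid setoid

  pow≈^ : ∀ x n → pow x n ≈ x ^ n
  pow≈^ x zero    = refl
  pow≈^ x (suc n) = *-congˡ (pow≈^ x n)

  pow-+ : ∀ x m n → pow x (m ℕ.+ n) ≈ pow x m * pow x n
  pow-+ x m n = begin
    pow x (m ℕ.+ n)    ≈⟨ pow≈^ x (m ℕ.+ n) ⟩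
    x ^ (m ℕ.+ n)      ≈⟨ ^-homo-* x m n ⟩
    x ^ m * x ^ n      ≈⟨ *-cong (pow≈^ x m) (pow≈^ x n) ⟨
    pow x m * pow x n  ∎

  pow-inverse : ∀ {a b} → b * a ≈ 1# → ∀ n → pow b n * pow a n ≈ 1#
  pow-inverse ba≈1 zero    = *-identityˡ 1#
  pow-inverse {a} {b} ba≈1 (suc n) = begin
    (b * pow b n) * (a * pow a n)  ≈⟨ interchange b (pow b n) a (pow a n) ⟩
    (b * a) * (pow b n * pow a n)  ≈⟨ *-cong ba≈1 (pow-inverse ba≈1 n) ⟩
    1# * 1#                        ≈⟨ *-identityˡ 1# ⟩
    1#                             ∎

  pow-cancel : ∀ {a b} → b * a ≈ 1# → ∀ {j n} → j ≤ n → pow b n * pow a j ≈ pow b (n ∸ j)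
  pow-cancel {a} {b} ba≈1 {j} {n} j≤n = begin
    pow b n * pow a j                      ≡⟨ ≡.cong (λ e → pow b e * pow a j) (≡.sym (ℕₚ.m∸n+n≡m j≤n)) ⟩
    pow b (n ∸ j ℕ.+ j) * pow a j          ≈⟨ *-congʳ (pow-+ b (n ∸ j) j) ⟩
    (pow b (n ∸ j) * pow b j) * pow a j    ≈⟨ *-assoc _ _ _ ⟩
    pow b (n ∸ j) * (pow b j * pow a j)    ≈⟨ *-congˡ (pow-inverse ba≈1 j) ⟩
    pow b (n ∸ j) * 1#                     ≈⟨ *-identityʳ _ ⟩
    pow b (n ∸ j)                          ∎

  -1*-1≈1 : - 1# * - 1# ≈ 1#
  -1*-1≈1 = trans (-1*x≈-x (- 1#)) (-‿involutive 1#)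

module Determinants {c ℓ} (R : CommutativeRing c ℓ) where
  open CommutativeRing R hiding (zero)
  open QDet R using (pow; sumFin; det)
  open import Algebra.Properties.Semiring.Sum semiring public
    using (sum; sum-syntax; sum-cong-≋; sum-replicate-zero; *-distribˡ-sum)
  open import Relation.Binary.Reasoning.Setoid setoid

  sumFin≡sum : ∀ n (f : Fin n → Carrier) → sumFin n f ≡ sum f
  sumFin≡sum zero    f = ≡.refl
  sumFin≡sum (suc n) f = ≡.cong (f Fin.zero +_) (sumFin≡sum n (f ∘ Fin.suc))

  sum-zero : ∀ {n} {f : Fin n → Carrier} → (∀ i → f i ≈ 0#) → sum f ≈ 0#
  sum-zero {n} f≈0 = trans (sum-cong-≋ f≈0) (sum-replicate-zero n)

  punchInℕ : ℕ → ℕ → ℕ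
  punchInℕ zero    u       = suc u
  punchInℕ (suc j) zero    = zero
  punchInℕ (suc j) (suc u) = suc (punchInℕ j u)

  toℕ-punchIn : ∀ {n} (j : Fin (suc n)) (u : Fin n) → toℕ (punchIn j u) ≡ punchInℕ (toℕ j) (toℕ u)
  toℕ-punchIn Fin.zero    u           = ≡.refl
  toℕ-punchIn (Fin.suc j) Fin.zero    = ≡.refl
  toℕ-punchIn (Fin.suc j) (Fin.suc u) = ≡.cong suc (toℕ-punchIn j u)

  Matrix : Set c
  Matrix = ℕ → ℕ → Carrier

  deleteColumn : ℕ → Matrix → Matrix
  deleteColumn j A r u = A r (punchInℕ j u)

  sign : ℕ → Carrier
  sign = pow (- 1#)

  -- QDet.det for ℕ-indexed matrices, so that minors and index shifts of the band matrices
  -- below reduce definitionally.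
  detℕ : ℕ → Matrix → Carrier
  expansionTerm : ℕ → Matrix → ℕ → Carrier

  detℕ zero    A = 1#
  detℕ (suc n) A = ∑[ j < suc n ] expansionTerm n A (toℕ j)

  expansionTerm n A j = sign j * (A 0 j * detℕ n (deleteColumn j (A ∘ suc)))

  det≈detℕ : ∀ n {M : Fin n → Fin n → Carrier} {A : Matrix} →
             (∀ r u → M r u ≈ A (toℕ r) (toℕ u)) → det n M ≈ detℕ n A
  det≈detℕ zero    M≈A = refl
  det≈detℕ (suc n) {M} {A} M≈A = begin
    det (suc n) M    ≡⟨ sumFin≡sum (suc n) termM ⟩
    sum termM        ≈⟨ sum-cong-≋ termM≈termA ⟩
    detℕ (suc n) A   ∎
    where
    termM : Fin (suc n) → Carrier
    termM j = sign (toℕ j) * (M Fin.zero j * det n (λ r u → M (Fin.suc r) (punchIn j u)))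

    minor≈ : ∀ j r u → M (Fin.suc r) (punchIn j u) ≈ deleteColumn (toℕ j) (A ∘ suc) (toℕ r) (toℕ u)
    minor≈ j r u = trans (M≈A (Fin.suc r) (punchIn j u))
                         (reflexive (≡.cong (A (suc (toℕ r))) (toℕ-punchIn j u)))

    termM≈termA : ∀ j → termM j ≈ expansionTerm n A (toℕ j)
    termM≈termA j = *-congˡ (*-cong (M≈A Fin.zero j) (det≈detℕ n (minor≈ j)))

  expansionTerm-entry-zero : ∀ n A j → A 0 j ≈ 0# → expansionTerm n A j ≈ 0#
  expansionTerm-entry-zero n A j a≈0 = trans (*-congˡ (trans (*-congʳ a≈0) (zeroˡ _))) (zeroʳ _)

  expansionTerm-minor-zero : ∀ n A j → detℕ n (deleteColumn j (A ∘ suc)) ≈ 0# → expansionTerm n A j ≈ 0#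
  expansionTerm-minor-zero n A j d≈0 = trans (*-congˡ (trans (*-congˡ d≈0) (zeroʳ _))) (zeroʳ _)

  detℕ-zero-column : ∀ n A (k : Fin n) → (∀ r → A r (toℕ k) ≈ 0#) → detℕ n A ≈ 0#
  detℕ-zero-column (suc n) A k colₖ≈0 = sum-zero vanishing
    where
    vanishing : ∀ j → expansionTerm n A (toℕ j) ≈ 0#
    vanishing j with j Fin.≟ k
    ... | yes ≡.refl = expansionTerm-entry-zero n A (toℕ j) (colₖ≈0 0)
    ... | no j≢k     = expansionTerm-minor-zero n A (toℕ j)
      (detℕ-zero-column n _ (punchOut j≢k) λ r →
        trans (reflexive (≡.cong (A (suc r)) hit)) (colₖ≈0 (suc r)))
      where
      hit : punchInℕ (toℕ j) (toℕ (punchOut j≢k)) ≡ toℕ k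
      hit = ≡.trans (≡.sym (toℕ-punchIn j _)) (≡.cong toℕ (punchIn-punchOut j≢k))

  detℕ-laplace-head : ∀ n A → (∀ (j : Fin n) → expansionTerm n A (suc (toℕ j)) ≈ 0#) →
                      detℕ (suc n) A ≈ A 0 0 * detℕ n (deleteColumn 0 (A ∘ suc))
  detℕ-laplace-head n A tail≈0 = trans (+-cong (*-identityˡ _) (sum-zero tail≈0)) (+-identityʳ _)

  detℕ-expand-col₀ : ∀ n A → (∀ r → A (suc r) 0 ≈ 0#) →
                     detℕ (suc n) A ≈ A 0 0 * detℕ n (deleteColumn 0 (A ∘ suc))
  detℕ-expand-col₀ zero    A _      = detℕ-laplace-head zero A λ ()
  detℕ-expand-col₀ (suc n) A col₀≈0 = detℕ-laplace-head (suc n) A λ j →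
    expansionTerm-minor-zero (suc n) A (suc (toℕ j))
      (detℕ-zero-column (suc n) (deleteColumn (suc (toℕ j)) (A ∘ suc)) Fin.zero col₀≈0)

  detℕ-expand-row₀ : ∀ n A → (∀ u → A 0 (suc u) ≈ 0#) →
                     detℕ (suc n) A ≈ A 0 0 * detℕ n (deleteColumn 0 (A ∘ suc))
  detℕ-expand-row₀ n A row₀≈0 = detℕ-laplace-head n A λ j →
    expansionTerm-entry-zero n A (suc (toℕ j)) (row₀≈0 (toℕ j))

module GaussianBinomial {c ℓ} (R : CommutativeRing c ℓ) (q : CommutativeRing.Carrier R) where
  open CommutativeRing R hiding (zero)
  open QDet R using (pow; qbinom)
  open PowerProperties R using (pow-+)
  open import Algebra.Solver.Ring.NaturalCoefficients.Default commutativeSemiring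
  open import Relation.Binary.Reasoning.Setoid setoid

  qbinom-above : ∀ {n k} → n < k → qbinom q n k ≈ 0#
  qbinom-above {zero}  {suc k} _         = refl
  qbinom-above {suc n} {suc k} (s≤s n<k) =
    trans (+-cong (qbinom-above n<k) (trans (*-congˡ (qbinom-above (ℕₚ.m<n⇒m<1+n n<k))) (zeroʳ _)))
          (+-identityʳ 0#)

  qbinom-diagonal : ∀ n → qbinom q n n ≈ 1#
  qbinom-diagonal zero    = refl
  qbinom-diagonal (suc n) =
    trans (+-cong (qbinom-diagonal n) (trans (*-congˡ (qbinom-above (ℕₚ.n<1+n n))) (zeroʳ _)))
          (+-identityʳ 1#)

  -- The q-analogue of (n choose k) (k choose j) = (n choose j) (n − j choose k − j).
  qbinom-trinomial : ∀ a b c →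
    qbinom q (a ℕ.+ b ℕ.+ c) (a ℕ.+ b) * qbinom q (a ℕ.+ b) a
      ≈ qbinom q (a ℕ.+ b ℕ.+ c) a * qbinom q (b ℕ.+ c) b
  qbinom-trinomial zero b c = *-comm _ _
  qbinom-trinomial (suc a) zero c
    rewrite ℕₚ.+-identityʳ a = *-congˡ (qbinom-diagonal (suc a))
  qbinom-trinomial (suc a) (suc b) zero
    rewrite ℕₚ.+-identityʳ (a ℕ.+ suc b) | ℕₚ.+-identityʳ b =
    trans (*-congʳ (qbinom-diagonal (suc (a ℕ.+ suc b))))
          (trans (*-comm _ _) (*-congˡ (sym (qbinom-diagonal (suc b)))))
  qbinom-trinomial (suc a) (suc b) (suc c) = begin
    (x₁ + qᴬ * x₂) * (y₁ + qᵃ * y₂)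
      ≈⟨ solve 6 (λ x₁ x₂ y₁ y₂ qᵃ qᴬ →
             (x₁ :+ qᴬ :* x₂) :* (y₁ :+ qᵃ :* y₂)
          := x₁ :* y₁ :+ qᵃ :* (x₁ :* y₂) :+ qᴬ :* (x₂ :* (y₁ :+ qᵃ :* y₂))) refl
           x₁ x₂ y₁ y₂ qᵃ qᴬ ⟩
    x₁ * y₁ + qᵃ * (x₁ * y₂) + qᴬ * (x₂ * (y₁ + qᵃ * y₂))
      ≈⟨ +-cong (+-cong (qbinom-trinomial a (suc b) (suc c)) (*-congˡ shifted-a))
                (*-cong (pow-+ q (suc a) (suc b)) shifted-ab) ⟩
    X₀ * (z₁ + qᵇ * z₂) + qᵃ * (X₁ * z₁) + (qᵃ * qᵇ) * (X₁ * z₂)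
      ≈⟨ solve 6 (λ X₀ X₁ z₁ z₂ qᵃ qᵇ →
             X₀ :* (z₁ :+ qᵇ :* z₂) :+ qᵃ :* (X₁ :* z₁) :+ (qᵃ :* qᵇ) :* (X₁ :* z₂)
          := (X₀ :+ qᵃ :* X₁) :* (z₁ :+ qᵇ :* z₂)) refl
           X₀ X₁ z₁ z₂ qᵃ qᵇ ⟩
    (X₀ + qᵃ * X₁) * (z₁ + qᵇ * z₂)
      ∎
    where
    A = a ℕ.+ suc b
    X = A ℕ.+ suc c
    x₁ = qbinom q X A
    x₂ = qbinom q X (suc A)
    y₁ = qbinom q A a
    y₂ = qbinom q A (suc a)
    X₀ = qbinom q X a
    X₁ = qbinom q X (suc a)
    z₁ = qbinom q (b ℕ.+ suc c) b
    z₂ = qbinom q (b ℕ.+ suc c) (suc b)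
    qᵃ = pow q (suc a)
    qᵇ = pow q (suc b)
    qᴬ = pow q (suc A)

    shifted-a : x₁ * y₂ ≈ X₁ * z₁
    shifted-a rewrite ℕₚ.+-suc a b = qbinom-trinomial (suc a) b (suc c)

    shifted-ab : x₂ * (y₁ + qᵃ * y₂) ≈ X₁ * z₂
    shifted-ab rewrite ℕₚ.+-suc A c | ℕₚ.+-suc b c = qbinom-trinomial (suc a) (suc b) c

module BandMatrix {c ℓ} (R : CommutativeRing c ℓ)
                  (q : CommutativeRing.Carrier R) (β : ℕ → CommutativeRing.Carrier R) where
  open CommutativeRing R hiding (zero)
  open QDet R using (pow; qbinom; Mmat)
  open Determinants R
  open GaussianBinomial R q using (qbinom-diagonal; qbinom-trinomial)
  open PowerProperties R using (pow-cancel; -1*-1≈1)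
  open import Algebra.Solver.Ring.NaturalCoefficients.Default commutativeSemiring
  open import Relation.Binary.Reasoning.Setoid setoid

  -- Rows 1, 2, … of M_n(x) with all binomial indices shifted by s: removing the first
  -- row and column of band s leaves band (suc s).
  band : ℕ → Matrix
  band s zero    u       = qbinom q (s ℕ.+ u) s * β u
  band s (suc i) zero    = 0#
  band s (suc i) (suc u) = band (suc s) i u

  band-upper : ∀ s {i u} → i ≤ u → band s i u ≡ qbinom q (s ℕ.+ u) (s ℕ.+ i) * β (u ∸ i)
  band-upper s {zero}  _         = ≡.cong (λ k → qbinom q (s ℕ.+ _) k * β _) (≡.sym (ℕₚ.+-identityʳ s))
  band-upper s {suc i} {suc u} (s≤s i≤u) = ≡.trans (band-upper (suc s) i≤u)
    (≡.cong₂ (λ m k → qbinom q m k * β (u ∸ i)) (≡.sym (ℕₚ.+-suc s u)) (≡.sym (ℕₚ.+-suc s i)))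

  band-lower : ∀ s {i u} → u < i → band s i u ≡ 0#
  band-lower s {suc i} {zero}  _         = ≡.refl
  band-lower s {suc i} {suc u} (s≤s u<i) = band-lower (suc s) u<i

  band-diagonal : ∀ s → band s 0 0 ≈ β 0
  band-diagonal s = begin
    qbinom q (s ℕ.+ 0) s * β 0   ≡⟨ ≡.cong (λ m → qbinom q m s * β 0) (ℕₚ.+-identityʳ s) ⟩
    qbinom q s s * β 0           ≈⟨ *-congʳ (qbinom-diagonal s) ⟩
    1# * β 0                     ≈⟨ *-identityˡ (β 0) ⟩
    β 0                          ∎

  hessenberg : ℕ → ℕ → Carrier
  hessenberg s m = detℕ m (deleteColumn 0 (band s))

  detℕ-band-deleteColumn : ∀ s n j → j ≤ n →
    detℕ n (deleteColumn j (band s)) ≈ pow (β 0) j * hessenberg (j ℕ.+ s) (n ∸ j)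
  detℕ-band-deleteColumn s n       zero    _         = sym (*-identityˡ _)
  detℕ-band-deleteColumn s (suc n) (suc j) (s≤s j≤n) = begin
    detℕ (suc n) (deleteColumn (suc j) (band s))
      ≈⟨ detℕ-expand-col₀ n (deleteColumn (suc j) (band s)) (λ _ → refl) ⟩
    band s 0 0 * detℕ n (deleteColumn j (band (suc s)))
      ≈⟨ *-cong (band-diagonal s) (detℕ-band-deleteColumn (suc s) n j j≤n) ⟩
    β 0 * (pow (β 0) j * hessenberg (j ℕ.+ suc s) (n ∸ j))
      ≈⟨ *-assoc _ _ _ ⟨
    pow (β 0) (suc j) * hessenberg (j ℕ.+ suc s) (n ∸ j)
      ≡⟨ ≡.cong (λ t → pow (β 0) (suc j) * hessenberg t (n ∸ j)) (ℕₚ.+-suc j s) ⟩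
    pow (β 0) (suc j) * hessenberg (suc j ℕ.+ s) (suc n ∸ suc j)
      ∎

  expansionWeight : ℕ → Carrier
  expansionWeight k = sign k * (β (suc k) * pow (β 0) k)

  hessenbergTerm : ℕ → ℕ → ℕ → Carrier
  hessenbergTerm s m k =
    qbinom q (s ℕ.+ suc k) s * (hessenberg (s ℕ.+ suc k) (m ∸ k) * expansionWeight k)

  hessenberg-expand : ∀ s m → hessenberg s (suc m) ≈ ∑[ k < suc m ] hessenbergTerm s m (toℕ k)
  hessenberg-expand s m = sum-cong-≋ λ (k : Fin (suc m)) → term≈ (toℕ k) (toℕ≤pred[n] k)
    where
    term≈ : ∀ k → k ≤ m → expansionTerm m (deleteColumn 0 (band s)) k ≈ hessenbergTerm s m k
    term≈ k k≤m = begin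
      sign k * ((Q * β (suc k)) * detℕ m (deleteColumn k (band (suc s))))
        ≈⟨ *-congˡ (*-congˡ (detℕ-band-deleteColumn (suc s) m k k≤m)) ⟩
      sign k * ((Q * β (suc k)) * (pow (β 0) k * hessenberg (k ℕ.+ suc s) (m ∸ k)))
        ≡⟨ ≡.cong (λ t → sign k * ((Q * β (suc k)) * (pow (β 0) k * hessenberg t (m ∸ k))))
                  (≡.trans (ℕₚ.+-comm k (suc s)) (≡.sym (ℕₚ.+-suc s k))) ⟩
      sign k * ((Q * β (suc k)) * (pow (β 0) k * H))
        ≈⟨ solve 5 (λ σ Q b p H → σ :* ((Q :* b) :* (p :* H)) := Q :* (H :* (σ :* (b :* p)))) refl
                 (sign k) Q (β (suc k)) (pow (β 0) k) H ⟩
      hessenbergTerm s m k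
        ∎
      where
      Q = qbinom q (s ℕ.+ suc k) s
      H = hessenberg (s ℕ.+ suc k) (m ∸ k)

  hessenberg-shift : ∀ m s → hessenberg s m ≈ qbinom q (s ℕ.+ m) s * hessenberg 0 m
  hessenberg-shift = <-rec Shifts step
    where
    Shifts : ℕ → Set ℓ
    Shifts m = ∀ s → hessenberg s m ≈ qbinom q (s ℕ.+ m) s * hessenberg 0 m

    step : ∀ m → (∀ {d} → d < m → Shifts d) → Shifts m
    step zero _ s = sym (begin
      qbinom q (s ℕ.+ 0) s * 1#   ≡⟨ ≡.cong (λ t → qbinom q t s * 1#) (ℕₚ.+-identityʳ s) ⟩
      qbinom q s s * 1#           ≈⟨ *-congʳ (qbinom-diagonal s) ⟩
      1# * 1#                     ≈⟨ *-identityˡ 1# ⟩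
      1#                          ∎)
    step (suc m) IH s = begin
      hessenberg s (suc m)
        ≈⟨ hessenberg-expand s m ⟩
      ∑[ k < suc m ] hessenbergTerm s m (toℕ k)
        ≈⟨ sum-cong-≋ (λ (k : Fin (suc m)) → term-shift (toℕ k) (toℕ≤pred[n] k)) ⟩
      ∑[ k < suc m ] (Q * hessenbergTerm 0 m (toℕ k))
        ≈⟨ *-distribˡ-sum {suc m} Q (λ k → hessenbergTerm 0 m (toℕ k)) ⟨
      Q * ∑[ k < suc m ] hessenbergTerm 0 m (toℕ k)
        ≈⟨ *-congˡ (hessenberg-expand 0 m) ⟨
      Q * hessenberg 0 (suc m)
        ∎
      where
      Q = qbinom q (s ℕ.+ suc m) s

      term-shift : ∀ k → k ≤ m → hessenbergTerm s m k ≈ Q * hessenbergTerm 0 m k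
      term-shift k k≤m = begin
        qbinom q t s * (hessenberg t d * w)
          ≈⟨ *-congˡ (*-congʳ (IH d<1+m t)) ⟩
        qbinom q t s * ((qbinom q (t ℕ.+ d) t * H) * w)
          ≈⟨ solve 4 (λ a b H w → a :* ((b :* H) :* w) := (b :* a) :* (H :* w)) refl
                   (qbinom q t s) (qbinom q (t ℕ.+ d) t) H w ⟩
        (qbinom q (t ℕ.+ d) t * qbinom q t s) * (H * w)
          ≈⟨ *-congʳ (qbinom-trinomial s (suc k) d) ⟩
        (qbinom q (t ℕ.+ d) s * B) * (H * w)
          ≡⟨ ≡.cong (λ n → (qbinom q n s * B) * (H * w)) t+d≡s+1+m ⟩
        (Q * B) * (H * w)
          ≈⟨ solve 4 (λ Q B H w → (Q :* B) :* (H :* w) := Q :* ((B :* H) :* w)) refl Q B H w ⟩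
        Q * ((B * H) * w)
          ≈⟨ *-congˡ (*-identityˡ _) ⟨
        Q * (1# * ((B * H) * w))
          ≈⟨ *-congˡ (*-congˡ (*-congʳ (IH d<1+m (suc k)))) ⟨
        Q * hessenbergTerm 0 m k
          ∎
        where
        t = s ℕ.+ suc k
        d = m ∸ k
        w = expansionWeight k
        H = hessenberg 0 d
        B = qbinom q (suc k ℕ.+ d) (suc k)
        d<1+m : d < suc m
        d<1+m = s≤s (ℕₚ.m∸n≤m m k)
        t+d≡s+1+m : t ℕ.+ d ≡ s ℕ.+ suc m
        t+d≡s+1+m = ≡.trans (ℕₚ.+-assoc s (suc k) d)
                            (≡.cong (λ e → s ℕ.+ suc e) (ℕₚ.m+[n∸m]≡n k≤m))

  Mℕ : Carrier → Matrix
  Mℕ x zero    u = pow x u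
  Mℕ x (suc r) u = band 0 r u

  Mmat≈Mℕ : ∀ n x (r u : Fin (suc n)) → Mmat q β n x r u ≈ Mℕ x (toℕ r) (toℕ u)
  Mmat≈Mℕ n x Fin.zero    u = refl
  Mmat≈Mℕ n x (Fin.suc r) u with toℕ r ℕ.≤? toℕ u
  ... | yes r≤u = reflexive (≡.sym (band-upper 0 r≤u))
  ... | no  r≰u = reflexive (≡.sym (band-lower 0 (ℕₚ.≰⇒> r≰u)))

  detℕ-Mℕ : ∀ n x → detℕ (suc n) (Mℕ x) ≈
    ∑[ j < suc n ] (sign (toℕ j) * (pow x (toℕ j) * (pow (β 0) (toℕ j) *
                    (qbinom q n (toℕ j) * hessenberg 0 (n ∸ toℕ j)))))
  detℕ-Mℕ n x = sum-cong-≋ λ (j : Fin (suc n)) → term≈ (toℕ j) (toℕ≤pred[n] j)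
    where
    minor≈ : ∀ j → j ≤ n →
      detℕ n (deleteColumn j (band 0)) ≈ pow (β 0) j * (qbinom q n j * hessenberg 0 (n ∸ j))
    minor≈ j j≤n = begin
      detℕ n (deleteColumn j (band 0))
        ≈⟨ detℕ-band-deleteColumn 0 n j j≤n ⟩
      pow (β 0) j * hessenberg (j ℕ.+ 0) (n ∸ j)
        ≡⟨ ≡.cong (λ t → pow (β 0) j * hessenberg t (n ∸ j)) (ℕₚ.+-identityʳ j) ⟩
      pow (β 0) j * hessenberg j (n ∸ j)
        ≈⟨ *-congˡ (hessenberg-shift (n ∸ j) j) ⟩
      pow (β 0) j * (qbinom q (j ℕ.+ (n ∸ j)) j * hessenberg 0 (n ∸ j))
        ≡⟨ ≡.cong (λ t → pow (β 0) j * (qbinom q t j * hessenberg 0 (n ∸ j))) (ℕₚ.m+[n∸m]≡n j≤n) ⟩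
      pow (β 0) j * (qbinom q n j * hessenberg 0 (n ∸ j))
        ∎

    term≈ : ∀ j → j ≤ n → expansionTerm n (Mℕ x) j ≈
      sign j * (pow x j * (pow (β 0) j * (qbinom q n j * hessenberg 0 (n ∸ j))))
    term≈ j j≤n = *-congˡ (*-congˡ (minor≈ j j≤n))

  detℕ-Mℕ-at-zero : ∀ n → detℕ (suc n) (Mℕ 0#) ≈ hessenberg 0 n
  detℕ-Mℕ-at-zero n = trans (detℕ-expand-row₀ n (Mℕ 0#) (λ u → zeroˡ (pow 0# u))) (*-identityˡ _)

  module _ (b : Carrier) where
    open QDet R using (P)

    P≈detℕ : ∀ m x → P q β b m x ≈ sign m * (pow b (suc m) * detℕ (suc m) (Mℕ x))
    P≈detℕ zero    x = sym (begin
      1# * ((b * 1#) * detℕ 1 (Mℕ x))   ≈⟨ *-identityˡ _ ⟩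
      (b * 1#) * detℕ 1 (Mℕ x)          ≈⟨ *-cong (*-identityʳ b) (detℕ-laplace-head 0 (Mℕ x) λ ()) ⟩
      b * (1# * 1#)                     ≈⟨ *-congˡ (*-identityˡ 1#) ⟩
      b * 1#                            ≈⟨ *-identityʳ b ⟩
      b                                 ∎)
    P≈detℕ (suc m) x = *-congˡ (*-congˡ (det≈detℕ (suc (suc m)) {A = Mℕ x} (Mmat≈Mℕ (suc m) x)))

    P-at-zero : ∀ m → P q β b m 0# ≈ sign m * (pow b (suc m) * hessenberg 0 m)
    P-at-zero m = trans (P≈detℕ m 0#) (*-congˡ (*-congˡ (detℕ-Mℕ-at-zero m)))

    P-expansion-term : b * β 0 ≈ 1# → ∀ n x j → j ≤ n →
      sign n * (pow b (suc n) * (sign j * (pow x j * (pow (β 0) j * (qbinom q n j * hessenberg 0 (n ∸ j))))))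
      ≈ qbinom q n j * (P q β b (n ∸ j) 0# * pow x j)
    P-expansion-term bβ₀≈1 n x j j≤n = begin
      sign n * (pow b (suc n) * (sign j * (pow x j * (pow (β 0) j * (Q * H)))))
        ≈⟨ solve 7 (λ σₙ bⁿ σⱼ xʲ βʲ Q H →
               σₙ :* (bⁿ :* (σⱼ :* (xʲ :* (βʲ :* (Q :* H)))))
            := Q :* (((σₙ :* σⱼ) :* ((bⁿ :* βʲ) :* H)) :* xʲ)) refl
             (sign n) (pow b (suc n)) (sign j) (pow x j) (pow (β 0) j) Q H ⟩
      Q * (((sign n * sign j) * ((pow b (suc n) * pow (β 0) j) * H)) * pow x j)
        ≈⟨ *-congˡ (*-congʳ (*-cong (pow-cancel -1*-1≈1 j≤n) (*-congʳ b-cancel))) ⟩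
      Q * ((sign (n ∸ j) * (pow b (suc (n ∸ j)) * H)) * pow x j)
        ≈⟨ *-congˡ (*-congʳ (P-at-zero (n ∸ j))) ⟨
      Q * (P q β b (n ∸ j) 0# * pow x j)
        ∎
      where
      Q = qbinom q n j
      H = hessenberg 0 (n ∸ j)
      b-cancel : pow b (suc n) * pow (β 0) j ≈ pow b (suc (n ∸ j))
      b-cancel = trans (pow-cancel bβ₀≈1 (ℕₚ.m≤n⇒m≤1+n j≤n))
                       (reflexive (≡.cong (pow b) (ℕₚ.+-∸-assoc 1 j≤n)))

mainTheorem3 : ∀ {c ℓ} (R : CommutativeRing c ℓ) →
    let open CommutativeRing R
        open QDet R
    in (q : Carrier) (β : ℕ → Carrier) (b : Carrier) → b * β 0 ≈ 1# →
       (n : ℕ) (x : Carrier) →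
       P q β b n x ≈ sumFin (suc n) (λ j → qbinom q n (toℕ j) * (P q β b (n ∸ toℕ j) 0# * pow x (toℕ j)))
mainTheorem3 R q β b bβ₀≈1 n x = begin
  P q β b n x
    ≈⟨ P≈detℕ b n x ⟩
  sign n * (pow b (suc n) * detℕ (suc n) (Mℕ x))
    ≈⟨ *-congˡ (*-congˡ (detℕ-Mℕ n x)) ⟩
  sign n * (pow b (suc n) * sum expansion)
    ≈⟨ trans (*-congˡ (*-distribˡ-sum (pow b (suc n)) expansion))
             (*-distribˡ-sum (sign n) (λ j → pow b (suc n) * expansion j)) ⟩
  ∑[ j < suc n ] (sign n * (pow b (suc n) * expansion j))
    ≈⟨ sum-cong-≋ (λ (j : Fin (suc n)) → P-expansion-term b bβ₀≈1 n x (toℕ j) (toℕ≤pred[n] j)) ⟩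
  sum appellTerm
    ≡⟨ sumFin≡sum (suc n) appellTerm ⟨
  sumFin (suc n) appellTerm
    ∎
  where
  open CommutativeRing R hiding (zero)
  open QDet R
  open Determinants R
  open BandMatrix R q β
  open import Relation.Binary.Reasoning.Setoid setoid

  expansion : Fin (suc n) → Carrier
  expansion j = sign (toℕ j) * (pow x (toℕ j) * (pow (β 0) (toℕ j) *
                (qbinom q n (toℕ j) * hessenberg 0 (n ∸ toℕ j))))

  appellTerm : Fin (suc n) → Carrier
  appellTerm j = qbinom q n (toℕ j) * (P q β b (n ∸ toℕ j) 0# * pow x (toℕ j))
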